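{- Let $\Psi:\mathbb{Q}[x]\to\mathbb{Q}$ be the linear form with $\Psi(x^n)=B_n$, where $\frac{t}{e^t-1}=\sum_{n\ge0}B_n\frac{t^n}{n!}$, and let $\mathscr{R}^-_n=\Psi\!\left(\binom{x+1}{2}^n\right)$ for $n\ge0$. Let $(R_n)_{n\ge0}$ be the Racah polynomials with parameters $(\alpha,\beta,\gamma,\delta)=(0,-1/2,0,0)$, and let $\Lambda$ be the unique linear form on $\mathbb{Q}[y]$ with $\Lambda(1)=1$ and $\Lambda(R_n)=0$ for all $n>0$. Then $\Lambda(y^n)=2^n\mathscr{R}^-_n$ for all $n\ge 0$, i.e. the numbers $(2^n\mathscr{R}^-_n)_{n\ge0}$ are the moments of this family of orthogonal polynomials.
   Context: For parameters $\alpha,\beta,\gamma,\delta$, the Racah polynomial $R_n$ is the polynomial of degree $n$ in a variable $y$ such that, with $\lambda(x)=x(x+\gamma+\delta+1)$, $$R_n(\lambda(x))=\sum_{k=0}^{n}\frac{(-n)_k(n+\alpha+\beta+1)_k(-x)_k(x+\gamma+\delta+1)_k}{(\alpha+1)_k(\beta+\delta+1)_k(\gamma+1)_k\,k!},$$ where $(a)_k=a(a+1)\cdots(a+k-1)$ is the Pochhammer symbol. The "moments" of the family are $\Lambda(y^n)$, $n\ge 0$. -}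

module Defs where

open import Data.Nat as ℕ using (ℕ; zero; suc)
open import Data.Nat.Combinatorics using ()
open import Data.Integer using (+_)
open import Data.Rational using (ℚ; 0ℚ; 1ℚ; _+_; _*_; -_; _/_; 1/_; ≢-nonZero)
open import Data.Rational.Properties using (_≟_)
open import Data.List using (List; []; _∷_)
open import Relation.Nullary using (yes; no)

ι : ℕ → ℚ
ι n = + n / 1

-- total reciprocal (only ever applied to nonzero arguments below)
inv : ℚ → ℚ
inv q with q ≟ 0ℚ
... | yes _ = 0ℚ
... | no q≢0 = 1/_ q {{≢-nonZero q≢0}}

_÷'_ : ℚ → ℚ → ℚ
p ÷' q = p * inv q

factℚ : ℕ → ℚ
factℚ zero = 1ℚ
factℚ (suc n) = ι (suc n) * factℚ n

poch : ℚ → ℕ → ℚ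
poch a zero = 1ℚ
poch a (suc k) = poch a k * (a + ι k)

_^ℚ_ : ℚ → ℕ → ℚ
q ^ℚ zero = 1ℚ
q ^ℚ suc n = q * (q ^ℚ n)

sumTo : ℕ → (ℕ → ℚ) → ℚ
sumTo zero f = f 0
sumTo (suc n) f = sumTo n f + f (suc n)

-- Polynomials over ℚ as coefficient lists (constant term first)

Poly : Set
Poly = List ℚ

evalP : Poly → ℚ → ℚ
evalP [] x = 0ℚ
evalP (c ∷ p) x = c + x * evalP p x

addP : Poly → Poly → Poly
addP [] q = q
addP (a ∷ p) [] = a ∷ p
addP (a ∷ p) (b ∷ q) = (a + b) ∷ addP p q

scaleP : ℚ → Poly → Poly
scaleP c [] = []
scaleP c (a ∷ p) = (c * a) ∷ scaleP c p

mulP : Poly → Poly → Poly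
mulP [] q = []
mulP (a ∷ p) q = addP (scaleP a q) (0ℚ ∷ mulP p q)

powP : Poly → ℕ → Poly
powP p zero = 1ℚ ∷ []
powP p (suc n) = mulP p (powP p n)

-- The linear form on ℚ[x] whose value on x^i is m i:
--   L_m (Σ c_i x^i) = Σ c_i m_i .
-- Every linear form on ℚ[x] is of this form (m i = value on x^i).
applyForm : (ℕ → ℚ) → Poly → ℚ
applyForm m [] = 0ℚ
applyForm m (c ∷ p) = c * m 0 + applyForm (λ i → m (suc i)) p

-- Bernoulli numbers via the generating function t/(e^t - 1) = Σ B_n t^n/n!,
-- i.e. the formal power series identity (Σ B_n t^n/n!) · (e^t - 1) = t,
-- compared coefficientwise.

expm1Coeff : ℕ → ℚ
expm1Coeff zero = 0ℚ
expm1Coeff (suc j) = inv (factℚ (suc j))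

delta1 : ℕ → ℚ
delta1 (suc zero) = 1ℚ
delta1 _ = 0ℚ

IsBernoulli : (ℕ → ℚ) → Set
IsBernoulli B = ∀ m →
  sumTo m (λ k → (B k ÷' factℚ k) * expm1Coeff (m ℕ.∸ k)) ≡ delta1 m
  where open import Relation.Binary.PropositionalEquality using (_≡_)

-- binom(x+1, 2) = (x^2 + x)/2 as a polynomial in x
binomX1-2 : Poly
binomX1-2 = 0ℚ ∷ (1ℚ ÷' ι 2) ∷ (1ℚ ÷' ι 2) ∷ []

Rminus : (ℕ → ℚ) → ℕ → ℚ
Rminus B n = applyForm B (powP binomX1-2 n)

racahRHS : (α β γ δ : ℚ) → ℕ → ℚ → ℚ
racahRHS α β γ δ n x = sumTo n (λ k →
  (poch (- ι n) k * poch (ι n + α + β + 1ℚ) k * poch (- x) k * poch (x + γ + δ + 1ℚ) k)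
  ÷' (poch (α + 1ℚ) k * poch (β + δ + 1ℚ) k * poch (γ + 1ℚ) k * factℚ k))

lam : (γ δ : ℚ) → ℚ → ℚ
lam γ δ x = x * (x + γ + δ + 1ℚ)

IsRacahFamily : (α β γ δ : ℚ) → (ℕ → Poly) → Set
IsRacahFamily α β γ δ P = ∀ n x → evalP (P n) (lam γ δ x) ≡ racahRHS α β γ δ n x
  where open import Relation.Binary.PropositionalEquality using (_≡_)

{-# OPTIONS --safe #-}
module Submission where

-- Write Ψ for the Bernoulli form and Δf(x) = f(x+1) - f(x).  The recurrence Σₖ C(i,k) Bₖ = Bᵢ + [i = 1]
-- says Ψ((x+1)ⁱ) = Bᵢ + [i = 1], i.e. Ψ(Δf) = f'(0) for every polynomial f.  At (α,β,γ,δ) = (0,-½,0,0)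
-- the basis φₖ(x) = (-x)ₖ(x+1)ₖ satisfies (2k+1)(-1)ᵏ φₖ = Δ[x ∏_{j≤k}(x² - j²)], so Rₙ(λ(x)) = ΔFₙ(x)
-- with Fₙ odd, and Ψ(Rₙ ∘ λ) = Fₙ'(0) is a terminating hypergeometric sum that vanishes for n > 0 by
-- Gosper's algorithm.  Hence the form yⁱ ↦ Ψ((x² + x)ⁱ) has the defining properties of Λ.  Such a form is
-- unique: Rₙ ∘ λ is triangular in the φₖ and λ φₖ = k(k+1) φₖ - φₖ₊₁, so every λʲ is a combination of 1
-- and the Rₙ ∘ λ with n > 0.  Finally x² + x = 2 binom(x+1, 2).

open import Defs
open import Data.Integer as ℤ using (+_)
import Data.Integer.Properties as ℤP
open import Data.List using ([]; _∷_; length)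
open import Data.List.Relation.Unary.All using (All; []; _∷_)
open import Data.Product using (Σ; _×_; _,_; proj₁; proj₂)
open import Data.Nat as ℕ using (ℕ; zero; suc; _!)
open import Data.Nat.Combinatorics using (_C_; nCk≡n!/k![n-k]!; k![n∸k]!∣n!; nCn≡1; k>n⇒nCk≡0; nCk+nC[k+1]≡[n+1]C[k+1])
open import Data.Nat.DivMod using (m/n*n≡m)
import Data.Nat.Coprimality as Coprime
import Data.Nat.Properties as ℕP
open import Data.Rational
open import Data.Rational.Properties
open import Algebra.Properties.Group +-0-group using (x∙y⁻¹≈ε⇒x≈y)
open import Data.Rational.Solver using (module +-*-Solver)
open import Function.Definitions using (Injective)
open import Data.Sum using (inj₁; inj₂)
open import Relation.Binary.Definitions using (tri<; tri≈; tri>)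
open import Relation.Binary.PropositionalEquality
open import Relation.Nullary using (yes; no; contradiction)

open +-*-Solver
open ≡-Reasoning

ι-suc : ∀ n → ι (suc n) ≡ ι n + 1ℚ
ι-suc n = begin
  + suc n / 1                     ≡⟨ cong (λ k → + k / 1) (ℕP.+-comm 1 n) ⟩
  (+ n ℤ.+ + 1) / 1               ≡⟨ cong (λ i → (i ℤ.+ + 1) / 1) (ℤP.*-identityʳ (+ n)) ⟨
  mkℚ (+ n) 0 coprime + 1ℚ        ≡⟨ cong (_+ 1ℚ) (sym (normalize-coprime coprime)) ⟩
  ι n + 1ℚ                        ∎
  where coprime = Coprime.sym (Coprime.1-coprimeTo n)

ι-+ : ∀ a b → ι (a ℕ.+ b) ≡ ι a + ι b
ι-+ zero b = sym (+-identityˡ (ι b))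
ι-+ (suc a) b = begin
  ι (suc (a ℕ.+ b))  ≡⟨ ι-suc (a ℕ.+ b) ⟩
  ι (a ℕ.+ b) + 1ℚ   ≡⟨ cong (_+ 1ℚ) (ι-+ a b) ⟩
  ι a + ι b + 1ℚ     ≡⟨ solve 2 (λ x y → x :+ y :+ con 1ℚ := x :+ con 1ℚ :+ y) refl (ι a) (ι b) ⟩
  ι a + 1ℚ + ι b     ≡⟨ cong (_+ ι b) (sym (ι-suc a)) ⟩
  ι (suc a) + ι b    ∎

ι-* : ∀ a b → ι (a ℕ.* b) ≡ ι a * ι b
ι-* zero b = sym (*-zeroˡ (ι b))
ι-* (suc a) b = begin
  ι (b ℕ.+ a ℕ.* b)   ≡⟨ ι-+ b (a ℕ.* b) ⟩
  ι b + ι (a ℕ.* b)   ≡⟨ cong (λ z → ι b + z) (ι-* a b) ⟩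
  ι b + ι a * ι b     ≡⟨ solve 2 (λ x y → y :+ x :* y := (x :+ con 1ℚ) :* y) refl (ι a) (ι b) ⟩
  (ι a + 1ℚ) * ι b    ≡⟨ cong (_* ι b) (sym (ι-suc a)) ⟩
  ι (suc a) * ι b     ∎

ι-injective : Injective _≡_ _≡_ ι
ι-injective {a} {b} ιa≡ιb = ℤP.+-injective (begin
  + a                               ≡⟨ cong ↥_ (normalize-coprime (Coprime.sym (Coprime.1-coprimeTo a))) ⟨
  ↥ ι a                             ≡⟨ cong ↥_ ιa≡ιb ⟩
  ↥ ι b                             ≡⟨ cong ↥_ (normalize-coprime (Coprime.sym (Coprime.1-coprimeTo b))) ⟩
  + b                               ∎)

ι-suc≢0 : ∀ n → ι (suc n) ≢ 0ℚ
ι-suc≢0 n e with ι-injective {suc n} {0} e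
... | ()

inv-inverseʳ : ∀ {p} → p ≢ 0ℚ → p * inv p ≡ 1ℚ
inv-inverseʳ {p} p≢0 with p ≟ 0ℚ
... | yes p≡0 = contradiction p≡0 p≢0
... | no p≢0′ = *-inverseʳ p {{≢-nonZero p≢0′}}

p*q≡0⇒q≡0 : ∀ {p q} → p ≢ 0ℚ → p * q ≡ 0ℚ → q ≡ 0ℚ
p*q≡0⇒q≡0 {p} {q} p≢0 pq≡0 = begin
  q                ≡⟨ *-identityˡ q ⟨
  1ℚ * q           ≡⟨ cong (_* q) (sym (inv-inverseʳ p≢0)) ⟩
  p * inv p * q    ≡⟨ solve 3 (λ p i q → p :* i :* q := i :* (p :* q)) refl p (inv p) q ⟩
  inv p * (p * q)  ≡⟨ cong (inv p *_) pq≡0 ⟩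
  inv p * 0ℚ       ≡⟨ *-zeroʳ (inv p) ⟩
  0ℚ               ∎

*-≢0 : ∀ {p q} → p ≢ 0ℚ → q ≢ 0ℚ → p * q ≢ 0ℚ
*-≢0 p≢0 q≢0 pq≡0 = q≢0 (p*q≡0⇒q≡0 p≢0 pq≡0)

p*q≢0⇒q≢0 : ∀ {p q} → p * q ≢ 0ℚ → q ≢ 0ℚ
p*q≢0⇒q≢0 {p} pq≢0 q≡0 = pq≢0 (trans (cong (p *_) q≡0) (*-zeroʳ p))

inv-unique : ∀ {p q} → p ≢ 0ℚ → p * q ≡ 1ℚ → inv p ≡ q
inv-unique {p} {q} p≢0 pq≡1 = begin
  inv p              ≡⟨ *-identityʳ (inv p) ⟨
  inv p * 1ℚ         ≡⟨ cong (inv p *_) (sym pq≡1) ⟩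
  inv p * (p * q)    ≡⟨ solve 3 (λ i p q → i :* (p :* q) := p :* i :* q) refl (inv p) p q ⟩
  p * inv p * q      ≡⟨ cong (_* q) (inv-inverseʳ p≢0) ⟩
  1ℚ * q             ≡⟨ *-identityˡ q ⟩
  q                  ∎

inv-* : ∀ {p q} → p ≢ 0ℚ → q ≢ 0ℚ → inv (p * q) ≡ inv p * inv q
inv-* {p} {q} p≢0 q≢0 = inv-unique (*-≢0 p≢0 q≢0) (begin
  p * q * (inv p * inv q)      ≡⟨ solve 4 (λ p q x y → p :* q :* (x :* y) := (p :* x) :* (q :* y)) refl p q (inv p) (inv q) ⟩
  (p * inv p) * (q * inv q)    ≡⟨ cong₂ _*_ (inv-inverseʳ p≢0) (inv-inverseʳ q≢0) ⟩
  1ℚ                           ∎)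

inv-≢0 : ∀ {p} → p ≢ 0ℚ → inv p ≢ 0ℚ
inv-≢0 {p} p≢0 inv≡0 = 1≢0 (begin
  1ℚ           ≡⟨ inv-inverseʳ p≢0 ⟨
  p * inv p    ≡⟨ cong (p *_) inv≡0 ⟩
  p * 0ℚ       ≡⟨ *-zeroʳ p ⟩
  0ℚ           ∎)

^ℚ-distribʳ-* : ∀ p q n → (p * q) ^ℚ n ≡ p ^ℚ n * q ^ℚ n
^ℚ-distribʳ-* p q zero = refl
^ℚ-distribʳ-* p q (suc n) = trans (cong (p * q *_) (^ℚ-distribʳ-* p q n)) (solve 4 (λ p q x y → p :* q :* (x :* y) := p :* x :* (q :* y)) refl p q (p ^ℚ n) (q ^ℚ n))

-- Polynomials and linear forms

X X+1 X²+X : Poly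
X = 0ℚ ∷ 1ℚ ∷ []
X+1 = 1ℚ ∷ 1ℚ ∷ []
X²+X = 0ℚ ∷ 1ℚ ∷ 1ℚ ∷ []

evalP-X : ∀ x → evalP X x ≡ x
evalP-X = solve 1 (λ x → con 0ℚ :+ x :* (con 1ℚ :+ x :* con 0ℚ) := x) refl

evalP-X+1 : ∀ x → evalP X+1 x ≡ x + 1ℚ
evalP-X+1 = solve 1 (λ x → con 1ℚ :+ x :* (con 1ℚ :+ x :* con 0ℚ) := x :+ con 1ℚ) refl

evalP-addP : ∀ p q x → evalP (addP p q) x ≡ evalP p x + evalP q x
evalP-addP [] q x = sym (+-identityˡ _)
evalP-addP (a ∷ p) [] x = sym (+-identityʳ _)
evalP-addP (a ∷ p) (b ∷ q) x = begin
  (a + b) + x * evalP (addP p q) x            ≡⟨ cong (λ z → (a + b) + x * z) (evalP-addP p q x) ⟩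
  (a + b) + x * (evalP p x + evalP q x)       ≡⟨ solve 5 (λ a b x P Q → (a :+ b) :+ x :* (P :+ Q) := (a :+ x :* P) :+ (b :+ x :* Q)) refl a b x (evalP p x) (evalP q x) ⟩
  (a + x * evalP p x) + (b + x * evalP q x)   ∎

evalP-scaleP : ∀ c p x → evalP (scaleP c p) x ≡ c * evalP p x
evalP-scaleP c [] x = sym (*-zeroʳ c)
evalP-scaleP c (a ∷ p) x = begin
  c * a + x * evalP (scaleP c p) x  ≡⟨ cong (λ z → c * a + x * z) (evalP-scaleP c p x) ⟩
  c * a + x * (c * evalP p x)       ≡⟨ solve 4 (λ c a x P → c :* a :+ x :* (c :* P) := c :* (a :+ x :* P)) refl c a x (evalP p x) ⟩
  c * (a + x * evalP p x)           ∎

evalP-mulP : ∀ p q x → evalP (mulP p q) x ≡ evalP p x * evalP q x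
evalP-mulP [] q x = sym (*-zeroˡ (evalP q x))
evalP-mulP (a ∷ p) q x = begin
  evalP (addP (scaleP a q) (0ℚ ∷ mulP p q)) x             ≡⟨ evalP-addP (scaleP a q) (0ℚ ∷ mulP p q) x ⟩
  evalP (scaleP a q) x + (0ℚ + x * evalP (mulP p q) x)    ≡⟨ cong₂ (λ u v → u + (0ℚ + x * v)) (evalP-scaleP a q x) (evalP-mulP p q x) ⟩
  a * evalP q x + (0ℚ + x * (evalP p x * evalP q x))      ≡⟨ solve 4 (λ a x P Q → a :* Q :+ (con 0ℚ :+ x :* (P :* Q)) := (a :+ x :* P) :* Q) refl a x (evalP p x) (evalP q x) ⟩
  (a + x * evalP p x) * evalP q x                         ∎

evalP-powP : ∀ p n x → evalP (powP p n) x ≡ evalP p x ^ℚ n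
evalP-powP p zero = solve 1 (λ x → con 1ℚ :+ x :* con 0ℚ := con 1ℚ) refl
evalP-powP p (suc n) x = trans (evalP-mulP p (powP p n) x) (cong (evalP p x *_) (evalP-powP p n x))

applyForm-addP : ∀ m p q → applyForm m (addP p q) ≡ applyForm m p + applyForm m q
applyForm-addP m [] q = sym (+-identityˡ _)
applyForm-addP m (a ∷ p) [] = sym (+-identityʳ _)
applyForm-addP m (a ∷ p) (b ∷ q) = begin
  (a + b) * m 0 + applyForm m′ (addP p q)                 ≡⟨ cong (λ z → (a + b) * m 0 + z) (applyForm-addP m′ p q) ⟩
  (a + b) * m 0 + (applyForm m′ p + applyForm m′ q)       ≡⟨ solve 5 (λ a b m P Q → (a :+ b) :* m :+ (P :+ Q) := (a :* m :+ P) :+ (b :* m :+ Q)) refl a b (m 0) (applyForm m′ p) (applyForm m′ q) ⟩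
  (a * m 0 + applyForm m′ p) + (b * m 0 + applyForm m′ q) ∎
  where m′ = λ i → m (suc i)

applyForm-scaleP : ∀ m c p → applyForm m (scaleP c p) ≡ c * applyForm m p
applyForm-scaleP m c [] = sym (*-zeroʳ c)
applyForm-scaleP m c (a ∷ p) = begin
  c * a * m 0 + applyForm m′ (scaleP c p)  ≡⟨ cong (λ z → c * a * m 0 + z) (applyForm-scaleP m′ c p) ⟩
  c * a * m 0 + c * applyForm m′ p         ≡⟨ solve 4 (λ c a m P → c :* a :* m :+ c :* P := c :* (a :* m :+ P)) refl c a (m 0) (applyForm m′ p) ⟩
  c * (a * m 0 + applyForm m′ p)           ∎
  where m′ = λ i → m (suc i)

applyForm-cong : ∀ {m m′} → (∀ i → m i ≡ m′ i) → ∀ p → applyForm m p ≡ applyForm m′ p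
applyForm-cong m≗m′ [] = refl
applyForm-cong m≗m′ (a ∷ p) = cong₂ (λ u v → a * u + v) (m≗m′ 0) (applyForm-cong (λ i → m≗m′ (suc i)) p)

applyForm-+ : ∀ m m′ p → applyForm (λ i → m i + m′ i) p ≡ applyForm m p + applyForm m′ p
applyForm-+ m m′ [] = sym (+-identityˡ 0ℚ)
applyForm-+ m m′ (a ∷ p) = begin
  a * (m 0 + m′ 0) + applyForm (λ i → m (suc i) + m′ (suc i)) p  ≡⟨ cong (λ z → a * (m 0 + m′ 0) + z) (applyForm-+ (λ i → m (suc i)) (λ i → m′ (suc i)) p) ⟩
  a * (m 0 + m′ 0) + (P + P′)                                     ≡⟨ solve 5 (λ a x y P P′ → a :* (x :+ y) :+ (P :+ P′) := (a :* x :+ P) :+ (a :* y :+ P′)) refl a (m 0) (m′ 0) P P′ ⟩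
  (a * m 0 + P) + (a * m′ 0 + P′)                                 ∎
  where P = applyForm (λ i → m (suc i)) p
        P′ = applyForm (λ i → m′ (suc i)) p

applyForm-diff : ∀ m m′ p → applyForm (λ i → m i - m′ i) p ≡ applyForm m p - applyForm m′ p
applyForm-diff m m′ [] = sym (+-inverseʳ 0ℚ)
applyForm-diff m m′ (a ∷ p) = begin
  a * (m 0 - m′ 0) + applyForm (λ i → m (suc i) - m′ (suc i)) p  ≡⟨ cong (λ z → a * (m 0 - m′ 0) + z) (applyForm-diff (λ i → m (suc i)) (λ i → m′ (suc i)) p) ⟩
  a * (m 0 - m′ 0) + (P - P′)                                     ≡⟨ solve 5 (λ a x y P P′ → a :* (x :- y) :+ (P :- P′) := (a :* x :+ P) :- (a :* y :+ P′)) refl a (m 0) (m′ 0) P P′ ⟩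
  (a * m 0 + P) - (a * m′ 0 + P′)                                 ∎
  where P = applyForm (λ i → m (suc i)) p
        P′ = applyForm (λ i → m′ (suc i)) p

applyForm-* : ∀ s m p → applyForm (λ i → s * m i) p ≡ s * applyForm m p
applyForm-* s m [] = sym (*-zeroʳ s)
applyForm-* s m (a ∷ p) = begin
  a * (s * m 0) + applyForm (λ i → s * m (suc i)) p  ≡⟨ cong (λ z → a * (s * m 0) + z) (applyForm-* s (λ i → m (suc i)) p) ⟩
  a * (s * m 0) + s * P                              ≡⟨ solve 4 (λ a s x P → a :* (s :* x) :+ s :* P := s :* (a :* x :+ P)) refl a s (m 0) P ⟩
  s * (a * m 0 + P)                                  ∎
  where P = applyForm (λ i → m (suc i)) p

applyForm-^ : ∀ t p → applyForm (t ^ℚ_) p ≡ evalP p t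
applyForm-^ t [] = refl
applyForm-^ t (a ∷ p) = begin
  a * 1ℚ + applyForm (λ i → t * t ^ℚ i) p  ≡⟨ cong (λ z → a * 1ℚ + z) (applyForm-* t (t ^ℚ_) p) ⟩
  a * 1ℚ + t * applyForm (t ^ℚ_) p         ≡⟨ cong (λ z → a * 1ℚ + t * z) (applyForm-^ t p) ⟩
  a * 1ℚ + t * evalP p t                   ≡⟨ cong (_+ t * evalP p t) (*-identityʳ a) ⟩
  a + t * evalP p t                        ∎

applyForm-mulP-∷ : ∀ m a p q → applyForm m (mulP (a ∷ p) q) ≡ a * applyForm m q + applyForm (λ i → m (suc i)) (mulP p q)
applyForm-mulP-∷ m a p q = begin
  applyForm m (addP (scaleP a q) (0ℚ ∷ mulP p q))  ≡⟨ applyForm-addP m (scaleP a q) (0ℚ ∷ mulP p q) ⟩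
  applyForm m (scaleP a q) + (0ℚ * m 0 + P)        ≡⟨ cong₂ (λ u v → u + (v + P)) (applyForm-scaleP m a q) (*-zeroˡ (m 0)) ⟩
  a * applyForm m q + (0ℚ + P)                     ≡⟨ cong (λ z → a * applyForm m q + z) (+-identityˡ P) ⟩
  a * applyForm m q + P                            ∎
  where P = applyForm (λ i → m (suc i)) (mulP p q)

applyForm-1 : ∀ m q → applyForm m (mulP (1ℚ ∷ []) q) ≡ applyForm m q
applyForm-1 m q = trans (applyForm-mulP-∷ m 1ℚ [] q) (solve 1 (λ x → con 1ℚ :* x :+ con 0ℚ := x) refl (applyForm m q))

applyForm-X^ : ∀ m i → applyForm m (powP X i) ≡ m i
applyForm-X^ m zero = solve 1 (λ x → con 1ℚ :* x :+ con 0ℚ := x) refl (m 0)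
applyForm-X^ m (suc i) = begin
  applyForm m (mulP X (powP X i))                                          ≡⟨ applyForm-mulP-∷ m 0ℚ (1ℚ ∷ []) (powP X i) ⟩
  0ℚ * applyForm m (powP X i) + applyForm m′ (mulP (1ℚ ∷ []) (powP X i))   ≡⟨ cong₂ _+_ (*-zeroˡ (applyForm m (powP X i))) (applyForm-1 m′ (powP X i)) ⟩
  0ℚ + applyForm m′ (powP X i)                                             ≡⟨ +-identityˡ _ ⟩
  applyForm m′ (powP X i)                                                  ≡⟨ applyForm-X^ m′ i ⟩
  m (suc i)                                                                ∎
  where m′ = λ i → m (suc i)

-- combine p (powP q) is the composite p ∘ q.
combine : Poly → (ℕ → Poly) → Poly
combine [] qs = []
combine (c ∷ p) qs = addP (scaleP c (qs 0)) (combine p (λ i → qs (suc i)))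

applyForm-combine : ∀ m p qs → applyForm m (combine p qs) ≡ applyForm (λ i → applyForm m (qs i)) p
applyForm-combine m [] qs = refl
applyForm-combine m (c ∷ p) qs = begin
  applyForm m (addP (scaleP c (qs 0)) (combine p qs′))               ≡⟨ applyForm-addP m (scaleP c (qs 0)) (combine p qs′) ⟩
  applyForm m (scaleP c (qs 0)) + applyForm m (combine p qs′)        ≡⟨ cong₂ _+_ (applyForm-scaleP m c (qs 0)) (applyForm-combine m p qs′) ⟩
  c * applyForm m (qs 0) + applyForm (λ i → applyForm m (qs′ i)) p   ∎
  where qs′ = λ i → qs (suc i)

evalP-combine : ∀ p qs x → evalP (combine p qs) x ≡ applyForm (λ i → evalP (qs i) x) p
evalP-combine [] qs x = refl
evalP-combine (c ∷ p) qs x = begin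
  evalP (addP (scaleP c (qs 0)) (combine p qs′)) x            ≡⟨ evalP-addP (scaleP c (qs 0)) (combine p qs′) x ⟩
  evalP (scaleP c (qs 0)) x + evalP (combine p qs′) x         ≡⟨ cong₂ _+_ (evalP-scaleP c (qs 0) x) (evalP-combine p qs′ x) ⟩
  c * evalP (qs 0) x + applyForm (λ i → evalP (qs′ i) x) p    ∎
  where qs′ = λ i → qs (suc i)

evalP-compose : ∀ p q x → evalP (combine p (powP q)) x ≡ evalP p (evalP q x)
evalP-compose p q x = begin
  evalP (combine p (powP q)) x                ≡⟨ evalP-combine p (powP q) x ⟩
  applyForm (λ i → evalP (powP q i) x) p      ≡⟨ applyForm-cong (λ i → evalP-powP q i x) p ⟩
  applyForm (evalP q x ^ℚ_) p                 ≡⟨ applyForm-^ (evalP q x) p ⟩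
  evalP p (evalP q x)                         ∎

IsZero : Poly → Set
IsZero = All (_≡ 0ℚ)

applyForm-IsZero : ∀ m {p} → IsZero p → applyForm m p ≡ 0ℚ
applyForm-IsZero m [] = refl
applyForm-IsZero m (_∷_ {c} {p} c≡0 p≡0) = begin
  c * m 0 + applyForm (λ i → m (suc i)) p  ≡⟨ cong₂ (λ u v → u * m 0 + v) c≡0 (applyForm-IsZero (λ i → m (suc i)) p≡0) ⟩
  0ℚ * m 0 + 0ℚ                            ≡⟨ solve 1 (λ x → con 0ℚ :* x :+ con 0ℚ := con 0ℚ) refl (m 0) ⟩
  0ℚ                                       ∎

quotient : Poly → ℚ → Poly
quotient [] a = []
quotient (c ∷ []) a = []
quotient (c ∷ p@(_ ∷ _)) a = evalP p a ∷ quotient p a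

length-quotient : ∀ c p a → length (quotient (c ∷ p) a) ≡ length p
length-quotient c [] a = refl
length-quotient c (d ∷ p) a = cong suc (length-quotient d p a)

evalP-quotient : ∀ p a y → evalP p y - evalP p a ≡ (y - a) * evalP (quotient p a) y
evalP-quotient [] a y = solve 2 (λ y a → con 0ℚ :- con 0ℚ := (y :- a) :* con 0ℚ) refl y a
evalP-quotient (c ∷ []) a y = solve 3 (λ c y a → (c :+ y :* con 0ℚ) :- (c :+ a :* con 0ℚ) := (y :- a) :* con 0ℚ) refl c y a
evalP-quotient (c ∷ p@(_ ∷ _)) a y = begin
  (c + y * evalP p y) - (c + a * e)      ≡⟨ solve 5 (λ c y a P e → (c :+ y :* P) :- (c :+ a :* e) := (y :- a) :* e :+ y :* (P :- e)) refl c y a (evalP p y) e ⟩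
  (y - a) * e + y * (evalP p y - e)      ≡⟨ cong (λ z → (y - a) * e + y * z) (evalP-quotient p a y) ⟩
  (y - a) * e + y * ((y - a) * Q)        ≡⟨ solve 4 (λ y a e Q → (y :- a) :* e :+ y :* ((y :- a) :* Q) := (y :- a) :* (e :+ y :* Q)) refl y a e Q ⟩
  (y - a) * (e + y * Q)                  ∎
  where e = evalP p a
        Q = evalP (quotient p a) y

IsZero-quotient⇒constant : ∀ p a → IsZero (quotient p a) → ∀ y → evalP p y ≡ evalP p a
IsZero-quotient⇒constant p a Q≡0 y = x∙y⁻¹≈ε⇒x≈y _ _ (begin
  evalP p y - evalP p a              ≡⟨ evalP-quotient p a y ⟩
  (y - a) * evalP (quotient p a) y   ≡⟨ cong ((y - a) *_) (trans (sym (applyForm-^ y (quotient p a))) (applyForm-IsZero (y ^ℚ_) Q≡0)) ⟩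
  (y - a) * 0ℚ                       ≡⟨ *-zeroʳ (y - a) ⟩
  0ℚ                                 ∎)

ι∘suc-injective : Injective _≡_ _≡_ (λ k → ι (suc k))
ι∘suc-injective e = ℕP.suc-injective (ι-injective e)

-- The quotient by X - a 0 vanishes on a ∘ suc, so p is the constant p (a 0) = 0.
vanishing⇒IsZero : ∀ {L} p → length p ℕ.≤ L → ∀ {a} → Injective _≡_ _≡_ a → (∀ k → evalP p (a k) ≡ 0ℚ) → IsZero p
vanishing⇒IsZero [] _ _ _ = []
vanishing⇒IsZero {suc L} (c ∷ p) (ℕ.s≤s |p|≤L) {a} a-injective vanishes =
  c≡0 ∷ vanishing⇒IsZero p |p|≤L ι∘suc-injective p-vanishes
  where
  Q = quotient (c ∷ p) (a 0)

  Q-vanishes : ∀ k → evalP Q (a (suc k)) ≡ 0ℚ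
  Q-vanishes k = p*q≡0⇒q≡0 a[1+k]-a₀≢0 (begin
    (a (suc k) - a 0) * evalP Q (a (suc k))              ≡⟨ evalP-quotient (c ∷ p) (a 0) (a (suc k)) ⟨
    evalP (c ∷ p) (a (suc k)) - evalP (c ∷ p) (a 0)      ≡⟨ cong₂ _-_ (vanishes (suc k)) (vanishes 0) ⟩
    0ℚ                                                   ∎)
    where
    a[1+k]-a₀≢0 : a (suc k) - a 0 ≢ 0ℚ
    a[1+k]-a₀≢0 e with a-injective (x∙y⁻¹≈ε⇒x≈y _ _ e)
    ... | ()

  Q≡0 : IsZero Q
  Q≡0 = vanishing⇒IsZero Q (ℕP.≤-trans (ℕP.≤-reflexive (length-quotient c p (a 0))) |p|≤L)
                           (λ e → ℕP.suc-injective (a-injective e)) Q-vanishes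

  vanishes-everywhere : ∀ y → evalP (c ∷ p) y ≡ 0ℚ
  vanishes-everywhere y = trans (IsZero-quotient⇒constant (c ∷ p) (a 0) Q≡0 y) (vanishes 0)

  c≡0 : c ≡ 0ℚ
  c≡0 = trans (solve 2 (λ c P → c := c :+ con 0ℚ :* P) refl c (evalP p 0ℚ)) (vanishes-everywhere 0ℚ)

  p-vanishes : ∀ k → evalP p (ι (suc k)) ≡ 0ℚ
  p-vanishes k = p*q≡0⇒q≡0 (ι-suc≢0 k) (begin
    ι (suc k) * evalP p (ι (suc k))         ≡⟨ +-identityˡ _ ⟨
    0ℚ + ι (suc k) * evalP p (ι (suc k))    ≡⟨ cong (λ z → z + ι (suc k) * evalP p (ι (suc k))) c≡0 ⟨
    evalP (c ∷ p) (ι (suc k))               ≡⟨ vanishes-everywhere (ι (suc k)) ⟩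
    0ℚ                                      ∎)

applyForm-cong-on : ∀ {a} → Injective _≡_ _≡_ a → ∀ m p q → (∀ k → evalP p (a k) ≡ evalP q (a k)) →
                    applyForm m p ≡ applyForm m q
applyForm-cong-on {a} a-injective m p q p≗q = x∙y⁻¹≈ε⇒x≈y _ _ (begin
  applyForm m p - applyForm m q                       ≡⟨ solve 2 (λ P Q → P :- Q := P :+ con (- 1ℚ) :* Q) refl (applyForm m p) (applyForm m q) ⟩
  applyForm m p + - 1ℚ * applyForm m q                ≡⟨ cong (λ z → applyForm m p + z) (applyForm-scaleP m (- 1ℚ) q) ⟨
  applyForm m p + applyForm m (scaleP (- 1ℚ) q)       ≡⟨ applyForm-addP m p (scaleP (- 1ℚ) q) ⟨
  applyForm m (addP p (scaleP (- 1ℚ) q))              ≡⟨ applyForm-IsZero m (vanishing⇒IsZero d ℕP.≤-refl a-injective d-vanishes) ⟩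
  0ℚ                                                  ∎)
  where
  d = addP p (scaleP (- 1ℚ) q)
  d-vanishes : ∀ k → evalP d (a k) ≡ 0ℚ
  d-vanishes k = begin
    evalP d (a k)                                        ≡⟨ evalP-addP p (scaleP (- 1ℚ) q) (a k) ⟩
    evalP p (a k) + evalP (scaleP (- 1ℚ) q) (a k)        ≡⟨ cong₂ _+_ (p≗q k) (evalP-scaleP (- 1ℚ) q (a k)) ⟩
    evalP q (a k) + - 1ℚ * evalP q (a k)                 ≡⟨ solve 1 (λ Q → Q :+ con (- 1ℚ) :* Q := con 0ℚ) refl (evalP q (a k)) ⟩
    0ℚ                                                   ∎

-- Finite sums, binomial coefficients and Bernoulli numbers

sumTo-cong : ∀ n {f g} → (∀ k → k ℕ.≤ n → f k ≡ g k) → sumTo n f ≡ sumTo n g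
sumTo-cong zero f≗g = f≗g 0 ℕ.z≤n
sumTo-cong (suc n) f≗g = cong₂ _+_ (sumTo-cong n (λ k k≤n → f≗g k (ℕP.m≤n⇒m≤1+n k≤n))) (f≗g (suc n) ℕP.≤-refl)

sumTo-+ : ∀ n f g → sumTo n (λ k → f k + g k) ≡ sumTo n f + sumTo n g
sumTo-+ zero f g = refl
sumTo-+ (suc n) f g = begin
  sumTo n (λ k → f k + g k) + (f (suc n) + g (suc n))    ≡⟨ cong (_+ (f (suc n) + g (suc n))) (sumTo-+ n f g) ⟩
  (sumTo n f + sumTo n g) + (f (suc n) + g (suc n))      ≡⟨ solve 4 (λ a b c d → (a :+ b) :+ (c :+ d) := (a :+ c) :+ (b :+ d)) refl (sumTo n f) (sumTo n g) (f (suc n)) (g (suc n)) ⟩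
  (sumTo n f + f (suc n)) + (sumTo n g + g (suc n))      ∎

sumTo-* : ∀ n c f → sumTo n (λ k → c * f k) ≡ c * sumTo n f
sumTo-* zero c f = refl
sumTo-* (suc n) c f = trans (cong (_+ c * f (suc n)) (sumTo-* n c f)) (sym (*-distribˡ-+ c (sumTo n f) (f (suc n))))

sumTo-diff : ∀ n f g → sumTo n (λ k → f k - g k) ≡ sumTo n f - sumTo n g
sumTo-diff zero f g = refl
sumTo-diff (suc n) f g = begin
  sumTo n (λ k → f k - g k) + (f (suc n) - g (suc n))    ≡⟨ cong (_+ (f (suc n) - g (suc n))) (sumTo-diff n f g) ⟩
  (sumTo n f - sumTo n g) + (f (suc n) - g (suc n))      ≡⟨ solve 4 (λ a b c d → (a :- b) :+ (c :- d) := (a :+ c) :- (b :+ d)) refl (sumTo n f) (sumTo n g) (f (suc n)) (g (suc n)) ⟩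
  (sumTo n f + f (suc n)) - (sumTo n g + g (suc n))      ∎

sumTo-suc : ∀ n f → sumTo (suc n) f ≡ f 0 + sumTo n (λ k → f (suc k))
sumTo-suc zero f = refl
sumTo-suc (suc n) f = trans (cong (_+ f (suc (suc n))) (sumTo-suc n f)) (+-assoc (f 0) _ _)

factℚ≢0 : ∀ n → factℚ n ≢ 0ℚ
factℚ≢0 zero ()
factℚ≢0 (suc n) = *-≢0 (ι-suc≢0 n) (factℚ≢0 n)

factℚ≡ι! : ∀ n → factℚ n ≡ ι (n !)
factℚ≡ι! zero = refl
factℚ≡ι! (suc n) = trans (cong (ι (suc n) *_) (factℚ≡ι! n)) (sym (ι-* (suc n) (n !)))

ι-C : ∀ {n k} → k ℕ.≤ n → ι (n C k) * (factℚ k * factℚ (n ℕ.∸ k)) ≡ factℚ n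
ι-C {n} {k} k≤n = begin
  ι (n C k) * (factℚ k * factℚ (n ℕ.∸ k))        ≡⟨ cong₂ (λ u v → ι (n C k) * (u * v)) (factℚ≡ι! k) (factℚ≡ι! (n ℕ.∸ k)) ⟩
  ι (n C k) * (ι (k !) * ι ((n ℕ.∸ k) !))        ≡⟨ cong (ι (n C k) *_) (ι-* (k !) ((n ℕ.∸ k) !)) ⟨
  ι (n C k) * ι (k ! ℕ.* (n ℕ.∸ k) !)            ≡⟨ ι-* (n C k) (k ! ℕ.* (n ℕ.∸ k) !) ⟨
  ι ((n C k) ℕ.* (k ! ℕ.* (n ℕ.∸ k) !))          ≡⟨ cong ι nCk*k![n∸k]!≡n! ⟩
  ι (n !)                                        ≡⟨ factℚ≡ι! n ⟨
  factℚ n                                        ∎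
  where
  nCk*k![n∸k]!≡n! : (n C k) ℕ.* (k ! ℕ.* (n ℕ.∸ k) !) ≡ n !
  nCk*k![n∸k]!≡n! = trans (cong (ℕ._* (k ! ℕ.* (n ℕ.∸ k) !)) (nCk≡n!/k![n-k]! k≤n))
                          (m/n*n≡m {{k ℕP.!* (n ℕ.∸ k) !≢0}} (k![n∸k]!∣n! k≤n))

pascal-sum : ∀ i (s : ℕ → ℚ) → sumTo (suc i) (λ k → ι (suc i C k) * s k)
                   ≡ sumTo i (λ k → ι (i C k) * s k) + sumTo i (λ k → ι (i C k) * s (suc k))
pascal-sum i s = begin
  sumTo (suc i) (λ k → ι (suc i C k) * s k)                          ≡⟨ sumTo-suc i (λ k → ι (suc i C k) * s k) ⟩
  1ℚ * s 0 + sumTo i (λ k → ι (suc i C suc k) * s (suc k))           ≡⟨ cong (λ z → 1ℚ * s 0 + z) (sumTo-cong i (λ k _ → pascal k)) ⟩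
  1ℚ * s 0 + sumTo i (λ k → ι (i C suc k) * s (suc k) + T k)         ≡⟨ cong (λ z → 1ℚ * s 0 + z) (sumTo-+ i _ T) ⟩
  1ℚ * s 0 + (sumTo i (λ k → ι (i C suc k) * s (suc k)) + sumTo i T) ≡⟨ +-assoc (1ℚ * s 0) _ _ ⟨
  (1ℚ * s 0 + sumTo i (λ k → ι (i C suc k) * s (suc k))) + sumTo i T ≡⟨ cong (_+ sumTo i T) (sumTo-suc i (λ k → ι (i C k) * s k)) ⟨
  sumTo (suc i) (λ k → ι (i C k) * s k) + sumTo i T                  ≡⟨ cong (_+ sumTo i T) (cong (λ z → sumTo i (λ k → ι (i C k) * s k) + z) top-term-vanishes) ⟩
  (sumTo i (λ k → ι (i C k) * s k) + 0ℚ) + sumTo i T                 ≡⟨ cong (_+ sumTo i T) (+-identityʳ (sumTo i (λ k → ι (i C k) * s k))) ⟩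
  sumTo i (λ k → ι (i C k) * s k) + sumTo i T                        ∎
  where
  T : ℕ → ℚ
  T k = ι (i C k) * s (suc k)
  pascal : ∀ k → ι (suc i C suc k) * s (suc k) ≡ ι (i C suc k) * s (suc k) + T k
  pascal k = begin
    ι (suc i C suc k) * s (suc k)                         ≡⟨ cong (λ c → ι c * s (suc k)) (nCk+nC[k+1]≡[n+1]C[k+1] i k) ⟨
    ι (i C k ℕ.+ i C suc k) * s (suc k)                   ≡⟨ cong (_* s (suc k)) (ι-+ (i C k) (i C suc k)) ⟩
    (ι (i C k) + ι (i C suc k)) * s (suc k)               ≡⟨ solve 3 (λ a b x → (a :+ b) :* x := b :* x :+ a :* x) refl (ι (i C k)) (ι (i C suc k)) (s (suc k)) ⟩
    ι (i C suc k) * s (suc k) + T k                       ∎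
  top-term-vanishes : ι (i C suc i) * s (suc i) ≡ 0ℚ
  top-term-vanishes = trans (cong (λ c → ι c * s (suc i)) (k>n⇒nCk≡0 (ℕP.n<1+n i))) (*-zeroˡ (s (suc i)))

applyForm-X+1^ : ∀ s i → applyForm s (powP X+1 i) ≡ sumTo i (λ k → ι (i C k) * s k)
applyForm-X+1^ s zero = solve 1 (λ x → con 1ℚ :* x :+ con 0ℚ := con 1ℚ :* x) refl (s 0)
applyForm-X+1^ s (suc i) = begin
  applyForm s (mulP X+1 (powP X+1 i))                                           ≡⟨ applyForm-mulP-∷ s 1ℚ (1ℚ ∷ []) (powP X+1 i) ⟩
  1ℚ * applyForm s (powP X+1 i) + applyForm s′ (mulP (1ℚ ∷ []) (powP X+1 i))    ≡⟨ cong₂ _+_ (*-identityˡ (applyForm s (powP X+1 i))) (applyForm-1 s′ (powP X+1 i)) ⟩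
  applyForm s (powP X+1 i) + applyForm s′ (powP X+1 i)                          ≡⟨ cong₂ _+_ (applyForm-X+1^ s i) (applyForm-X+1^ s′ i) ⟩
  sumTo i (λ k → ι (i C k) * s k) + sumTo i (λ k → ι (i C k) * s (suc k))       ≡⟨ pascal-sum i s ⟨
  sumTo (suc i) (λ k → ι (suc i C k) * s k)                                     ∎
  where s′ = λ k → s (suc k)

linearCoeff : Poly → ℚ
linearCoeff [] = 0ℚ
linearCoeff (_ ∷ p) = evalP p 0ℚ

applyForm-0 : ∀ p → applyForm (λ _ → 0ℚ) p ≡ 0ℚ
applyForm-0 [] = refl
applyForm-0 (c ∷ p) = trans (cong (λ z → c * 0ℚ + z) (applyForm-0 p)) (solve 1 (λ c → c :* con 0ℚ :+ con 0ℚ := con 0ℚ) refl c)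

applyForm-delta1 : ∀ p → applyForm delta1 p ≡ linearCoeff p
applyForm-delta1 [] = refl
applyForm-delta1 (c ∷ []) = solve 1 (λ c → c :* con 0ℚ :+ con 0ℚ := con 0ℚ) refl c
applyForm-delta1 (c ∷ d ∷ p) = begin
  c * 0ℚ + (d * 1ℚ + applyForm (λ _ → 0ℚ) p)  ≡⟨ cong (λ z → c * 0ℚ + (d * 1ℚ + z)) (applyForm-0 p) ⟩
  c * 0ℚ + (d * 1ℚ + 0ℚ)                      ≡⟨ solve 3 (λ c d P → c :* con 0ℚ :+ (d :* con 1ℚ :+ con 0ℚ) := d :+ con 0ℚ :* P) refl c d (evalP p 0ℚ) ⟩
  d + 0ℚ * evalP p 0ℚ                         ∎

expm1Coeff-suc∸ : ∀ {m k} → k ℕ.≤ m → expm1Coeff (suc m ℕ.∸ k) ≡ inv (factℚ (suc m ℕ.∸ k))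
expm1Coeff-suc∸ {m} k≤m rewrite ℕP.+-∸-assoc 1 k≤m = refl

-- The binomial coefficient in the shape of the Cauchy product in IsBernoulli.
ι-C-cauchy : ∀ {m k} → k ℕ.≤ m → ∀ b →
             ι (suc m C k) * b ≡ factℚ (suc m) * ((b ÷' factℚ k) * expm1Coeff (suc m ℕ.∸ k))
ι-C-cauchy {m} {k} k≤m b = begin
  ι c * b                                          ≡⟨ solve 2 (λ c b → c :* b := c :* b :* con 1ℚ :* con 1ℚ) refl (ι c) b ⟩
  ι c * b * 1ℚ * 1ℚ                                ≡⟨ cong₂ (λ u v → ι c * b * u * v) (inv-inverseʳ (factℚ≢0 k)) (inv-inverseʳ (factℚ≢0 j)) ⟨
  ι c * b * (k! * inv k!) * (j! * inv j!)          ≡⟨ solve 6 (λ c b f g fi gi → c :* b :* (f :* fi) :* (g :* gi) := (c :* (f :* g)) :* ((b :* fi) :* gi)) refl (ι c) b k! j! (inv k!) (inv j!) ⟩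
  ι c * (k! * j!) * ((b * inv k!) * inv j!)        ≡⟨ cong₂ (λ u v → u * ((b * inv k!) * v)) (ι-C (ℕP.m≤n⇒m≤1+n k≤m)) (sym (expm1Coeff-suc∸ k≤m)) ⟩
  factℚ (suc m) * ((b ÷' k!) * expm1Coeff j)       ∎
  where
  c = suc m C k
  j = suc m ℕ.∸ k
  k! = factℚ k
  j! = factℚ j

factℚ*delta1≡delta1 : ∀ m → factℚ (suc m) * delta1 (suc m) ≡ delta1 (suc m)
factℚ*delta1≡delta1 zero = refl
factℚ*delta1≡delta1 (suc m) = *-zeroʳ (factℚ (suc (suc m)))

module _ {B : ℕ → ℚ} (isBernoulli : IsBernoulli B) where

  bernoulli-binomial : ∀ i → sumTo i (λ k → ι (i C k) * B k) ≡ B i + delta1 i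
  bernoulli-binomial zero = solve 1 (λ b → con 1ℚ :* b := b :+ con 0ℚ) refl (B 0)
  bernoulli-binomial (suc m) = begin
    sumTo m (λ k → ι (suc m C k) * B k) + ι (suc m C suc m) * B (suc m)  ≡⟨ cong₂ _+_ lower-sum (cong (λ c → ι c * B (suc m)) (nCn≡1 (suc m))) ⟩
    delta1 (suc m) + 1ℚ * B (suc m)                                     ≡⟨ solve 2 (λ d b → d :+ con 1ℚ :* b := b :+ d) refl (delta1 (suc m)) (B (suc m)) ⟩
    B (suc m) + delta1 (suc m)                                          ∎
    where
    cauchy : ℕ → ℚ
    cauchy k = (B k ÷' factℚ k) * expm1Coeff (suc m ℕ.∸ k)

    cauchy-sum : sumTo m cauchy ≡ delta1 (suc m)
    cauchy-sum = begin
      sumTo m cauchy                        ≡⟨ +-identityʳ (sumTo m cauchy) ⟨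
      sumTo m cauchy + 0ℚ                   ≡⟨ cong (λ z → sumTo m cauchy + z) top-term-vanishes ⟨
      sumTo (suc m) cauchy                  ≡⟨ isBernoulli (suc m) ⟩
      delta1 (suc m)                        ∎
      where
      top-term-vanishes : cauchy (suc m) ≡ 0ℚ
      top-term-vanishes = trans (cong (λ j → (B (suc m) ÷' factℚ (suc m)) * expm1Coeff j) (ℕP.n∸n≡0 m))
                                (*-zeroʳ (B (suc m) ÷' factℚ (suc m)))

    lower-sum : sumTo m (λ k → ι (suc m C k) * B k) ≡ delta1 (suc m)
    lower-sum = begin
      sumTo m (λ k → ι (suc m C k) * B k)       ≡⟨ sumTo-cong m (λ k k≤m → ι-C-cauchy k≤m (B k)) ⟩
      sumTo m (λ k → factℚ (suc m) * cauchy k)  ≡⟨ sumTo-* m (factℚ (suc m)) cauchy ⟩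
      factℚ (suc m) * sumTo m cauchy            ≡⟨ cong (factℚ (suc m) *_) cauchy-sum ⟩
      factℚ (suc m) * delta1 (suc m)            ≡⟨ factℚ*delta1≡delta1 m ⟩
      delta1 (suc m)                            ∎

  applyForm-shift : ∀ p → applyForm B (combine p (powP X+1)) ≡ applyForm B p + linearCoeff p
  applyForm-shift p = begin
    applyForm B (combine p (powP X+1))                ≡⟨ applyForm-combine B p (powP X+1) ⟩
    applyForm (λ i → applyForm B (powP X+1 i)) p      ≡⟨ applyForm-cong (λ i → trans (applyForm-X+1^ B i) (bernoulli-binomial i)) p ⟩
    applyForm (λ i → B i + delta1 i) p                ≡⟨ applyForm-+ B delta1 p ⟩
    applyForm B p + applyForm delta1 p                ≡⟨ cong (λ z → applyForm B p + z) (applyForm-delta1 p) ⟩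
    applyForm B p + linearCoeff p                     ∎

  applyForm-Δ : ∀ f g → (∀ x → evalP g x ≡ evalP f (x + 1ℚ) - evalP f x) → applyForm B g ≡ linearCoeff f
  applyForm-Δ f g g≡Δf = begin
    applyForm B g                                                  ≡⟨ applyForm-cong-on ι-injective B g Δf (λ k → g≡Δf[x] (ι k)) ⟩
    applyForm B Δf                                                 ≡⟨ applyForm-addP B f₊₁ (scaleP (- 1ℚ) f) ⟩
    applyForm B f₊₁ + applyForm B (scaleP (- 1ℚ) f)                ≡⟨ cong₂ _+_ (applyForm-shift f) (applyForm-scaleP B (- 1ℚ) f) ⟩
    (applyForm B f + linearCoeff f) + - 1ℚ * applyForm B f         ≡⟨ solve 2 (λ a l → (a :+ l) :+ con (- 1ℚ) :* a := l) refl (applyForm B f) (linearCoeff f) ⟩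
    linearCoeff f                                                  ∎
    where
    f₊₁ = combine f (powP X+1)
    Δf = addP f₊₁ (scaleP (- 1ℚ) f)
    g≡Δf[x] : ∀ x → evalP g x ≡ evalP Δf x
    g≡Δf[x] x = begin
      evalP g x                                        ≡⟨ g≡Δf x ⟩
      evalP f (x + 1ℚ) - evalP f x                     ≡⟨ solve 2 (λ a b → a :- b := a :+ con (- 1ℚ) :* b) refl (evalP f (x + 1ℚ)) (evalP f x) ⟩
      evalP f (x + 1ℚ) + - 1ℚ * evalP f x              ≡⟨ cong₂ _+_ (trans (evalP-compose f X+1 x) (cong (evalP f) (evalP-X+1 x))) (evalP-scaleP (- 1ℚ) f x) ⟨
      evalP f₊₁ x + evalP (scaleP (- 1ℚ) f) x          ≡⟨ evalP-addP f₊₁ (scaleP (- 1ℚ) f) x ⟨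
      evalP Δf x                                       ∎

-- Racah polynomials with parameters (0, -½, 0, 0)

poch≢0 : ∀ a k → (∀ j → j ℕ.< k → a + ι j ≢ 0ℚ) → poch a k ≢ 0ℚ
poch≢0 a zero _ ()
poch≢0 a (suc k) factors≢0 = *-≢0 (poch≢0 a k (λ j j<k → factors≢0 j (ℕP.m<n⇒m<1+n j<k))) (factors≢0 k ℕP.≤-refl)

sgn : ℕ → ℚ
sgn k = (- 1ℚ) ^ℚ k

sgn*sgn≡1 : ∀ k → sgn k * sgn k ≡ 1ℚ
sgn*sgn≡1 zero = refl
sgn*sgn≡1 (suc k) = trans (solve 1 (λ s → (con (- 1ℚ) :* s) :* (con (- 1ℚ) :* s) := s :* s) refl (sgn k)) (sgn*sgn≡1 k)

oddℚ : ℕ → ℚ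
oddℚ k = ι 2 * ι k + 1ℚ

oddℚ≢0 : ∀ k → oddℚ k ≢ 0ℚ
oddℚ≢0 k = subst (_≢ 0ℚ) (trans (ι-suc (2 ℕ.* k)) (cong (_+ 1ℚ) (ι-* 2 k))) (ι-suc≢0 (2 ℕ.* k))

β₀ : ℚ
β₀ = - (1ℚ ÷' ι 2)

λ₀ : ℚ → ℚ
λ₀ = lam 0ℚ 0ℚ

φ : ℕ → ℚ → ℚ
φ k x = poch (- x) k * poch (x + 0ℚ + 0ℚ + 1ℚ) k

-- (-n)ₖ, (n + ½)ₖ, (½)ₖ and (1)ₖ (½)ₖ (1)ₖ k!, written exactly as racahRHS spells them at (0, β₀, 0, 0).
negPoch shiftPoch : ℕ → ℕ → ℚ
negPoch n k = poch (- ι n) k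
shiftPoch n k = poch (ι n + 0ℚ + β₀ + 1ℚ) k

halfPoch racahDen : ℕ → ℚ
halfPoch k = poch (β₀ + 0ℚ + 1ℚ) k
racahDen k = poch (0ℚ + 1ℚ) k * halfPoch k * poch (0ℚ + 1ℚ) k * factℚ k

racahCoeff : ℕ → ℕ → ℚ
racahCoeff n k = (negPoch n k * shiftPoch n k) * inv (racahDen k)

racahRHS≡Σφ : ∀ n x → racahRHS 0ℚ β₀ 0ℚ 0ℚ n x ≡ sumTo n (λ k → racahCoeff n k * φ k x)
racahRHS≡Σφ n x = sumTo-cong n (λ k _ →
  solve 5 (λ a b p q i → (a :* b :* p :* q) :* i := (a :* b) :* i :* (p :* q)) refl
          (negPoch n k) (shiftPoch n k) (poch (- x) k) (poch (x + 0ℚ + 0ℚ + 1ℚ) k) (inv (racahDen k)))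

λ₀*φ : ∀ k x → λ₀ x * φ k x ≡ ι k * (ι k + 1ℚ) * φ k x - φ (suc k) x
λ₀*φ k x = solve 4 (λ x K P Q → x :* (x :+ con 0ℚ :+ con 0ℚ :+ con 1ℚ) :* (P :* Q)
                                := K :* (K :+ con 1ℚ) :* (P :* Q) :- (P :* (:- x :+ K)) :* (Q :* (x :+ con 0ℚ :+ con 0ℚ :+ con 1ℚ :+ K)))
                   refl x (ι k) (poch (- x) k) (poch (x + 0ℚ + 0ℚ + 1ℚ) k)

poch-1 : ∀ k → poch (0ℚ + 1ℚ) k ≡ factℚ k
poch-1 zero = refl
poch-1 (suc k) = begin
  poch (0ℚ + 1ℚ) k * (0ℚ + 1ℚ + ι k)   ≡⟨ cong (_* (0ℚ + 1ℚ + ι k)) (poch-1 k) ⟩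
  factℚ k * (0ℚ + 1ℚ + ι k)            ≡⟨ solve 2 (λ f K → f :* (con 0ℚ :+ con 1ℚ :+ K) := (K :+ con 1ℚ) :* f) refl (factℚ k) (ι k) ⟩
  (ι k + 1ℚ) * factℚ k                 ≡⟨ cong (_* factℚ k) (ι-suc k) ⟨
  factℚ (suc k)                        ∎

halfPoch-factor≢0 : ∀ j → β₀ + 0ℚ + 1ℚ + ι j ≢ 0ℚ
halfPoch-factor≢0 j = p*q≢0⇒q≢0 {ι 2} (subst (_≢ 0ℚ)
  (solve 1 (λ J → con (ι 2) :* J :+ con 1ℚ := con (ι 2) :* (con β₀ :+ con 0ℚ :+ con 1ℚ :+ J)) refl (ι j))
  (oddℚ≢0 j))

inv-halfPoch-factor : ∀ j → inv (β₀ + 0ℚ + 1ℚ + ι j) ≡ ι 2 * inv (oddℚ j)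
inv-halfPoch-factor j = inv-unique (halfPoch-factor≢0 j) (begin
  (β₀ + 0ℚ + 1ℚ + ι j) * (ι 2 * inv (oddℚ j))   ≡⟨ solve 2 (λ J v → (con β₀ :+ con 0ℚ :+ con 1ℚ :+ J) :* (con (ι 2) :* v) := (con (ι 2) :* J :+ con 1ℚ) :* v) refl (ι j) (inv (oddℚ j)) ⟩
  oddℚ j * inv (oddℚ j)                         ≡⟨ inv-inverseʳ (oddℚ≢0 j) ⟩
  1ℚ                                            ∎)

halfPoch≢0 : ∀ k → halfPoch k ≢ 0ℚ
halfPoch≢0 k = poch≢0 _ k (λ j _ → halfPoch-factor≢0 j)

racahDen≢0 : ∀ k → racahDen k ≢ 0ℚ
racahDen≢0 k rewrite poch-1 k = *-≢0 (*-≢0 (*-≢0 (factℚ≢0 k) (halfPoch≢0 k)) (factℚ≢0 k)) (factℚ≢0 k)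

negPoch≢0 : ∀ n → negPoch n n ≢ 0ℚ
negPoch≢0 n = poch≢0 (- ι n) n (λ j j<n e → ℕP.<⇒≢ j<n (ι-injective (begin
  ι j                   ≡⟨ solve 2 (λ J N → J := (:- N :+ J) :+ N) refl (ι j) (ι n) ⟩
  (- ι n + ι j) + ι n   ≡⟨ cong (_+ ι n) e ⟩
  0ℚ + ι n              ≡⟨ +-identityˡ (ι n) ⟩
  ι n                   ∎)))

shiftPoch≢0 : ∀ n → shiftPoch n n ≢ 0ℚ
shiftPoch≢0 n = poch≢0 _ n (λ j _ → p*q≢0⇒q≢0 {ι 2} (subst (_≢ 0ℚ) (begin
  oddℚ (n ℕ.+ j)                         ≡⟨ cong (λ z → ι 2 * z + 1ℚ) (ι-+ n j) ⟩
  ι 2 * (ι n + ι j) + 1ℚ                 ≡⟨ solve 2 (λ N J → con (ι 2) :* (N :+ J) :+ con 1ℚ := con (ι 2) :* (N :+ con 0ℚ :+ con β₀ :+ con 1ℚ :+ J)) refl (ι n) (ι j) ⟩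
  ι 2 * (ι n + 0ℚ + β₀ + 1ℚ + ι j)       ∎) (oddℚ≢0 (n ℕ.+ j))))

racahCoeff≢0 : ∀ n → racahCoeff n n ≢ 0ℚ
racahCoeff≢0 n = *-≢0 (*-≢0 (negPoch≢0 n) (shiftPoch≢0 n)) (inv-≢0 (racahDen≢0 n))

sqProd : ℕ → ℚ → ℚ
sqProd zero x = 1ℚ
sqProd (suc k) x = sqProd k x * (x * x - ι (suc k) * ι (suc k))

sqProd-φ : ∀ k x → (x * sqProd k x ≡ (x - ι k) * (sgn k * φ k x))
                 × ((x + 1ℚ) * sqProd k (x + 1ℚ) ≡ (x + 1ℚ + ι k) * (sgn k * φ k x))
sqProd-φ zero x = solve 1 (λ x → x :* con 1ℚ := (x :- con 0ℚ) :* (con 1ℚ :* (con 1ℚ :* con 1ℚ))) refl x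
                , solve 1 (λ x → (x :+ con 1ℚ) :* con 1ℚ := (x :+ con 1ℚ :+ con 0ℚ) :* (con 1ℚ :* (con 1ℚ :* con 1ℚ))) refl x
sqProd-φ (suc k) x = left , right
  where
  K = ι k
  s = sgn k
  P = poch (- x) k
  Q = poch (x + 0ℚ + 0ℚ + 1ℚ) k
  left : x * sqProd (suc k) x ≡ (x - ι (suc k)) * (sgn (suc k) * φ (suc k) x)
  left = begin
    x * (sqProd k x * (x * x - ι (suc k) * ι (suc k)))          ≡⟨ *-assoc x (sqProd k x) _ ⟨
    x * sqProd k x * (x * x - ι (suc k) * ι (suc k))            ≡⟨ cong₂ (λ u v → u * (x * x - v * v)) (proj₁ (sqProd-φ k x)) (ι-suc k) ⟩
    (x - K) * (s * (P * Q)) * (x * x - (K + 1ℚ) * (K + 1ℚ))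
      ≡⟨ solve 5 (λ x K s P Q → (x :- K) :* (s :* (P :* Q)) :* (x :* x :- (K :+ con 1ℚ) :* (K :+ con 1ℚ))
                  := (x :- (K :+ con 1ℚ)) :* ((con (- 1ℚ) :* s) :* ((P :* (:- x :+ K)) :* (Q :* (x :+ con 0ℚ :+ con 0ℚ :+ con 1ℚ :+ K))))) refl x K s P Q ⟩
    (x - (K + 1ℚ)) * (sgn (suc k) * φ (suc k) x)                ≡⟨ cong (λ v → (x - v) * (sgn (suc k) * φ (suc k) x)) (ι-suc k) ⟨
    (x - ι (suc k)) * (sgn (suc k) * φ (suc k) x)               ∎
  right : (x + 1ℚ) * sqProd (suc k) (x + 1ℚ) ≡ (x + 1ℚ + ι (suc k)) * (sgn (suc k) * φ (suc k) x)
  right = begin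
    (x + 1ℚ) * (sqProd k (x + 1ℚ) * ((x + 1ℚ) * (x + 1ℚ) - ι (suc k) * ι (suc k)))  ≡⟨ *-assoc (x + 1ℚ) (sqProd k (x + 1ℚ)) _ ⟨
    (x + 1ℚ) * sqProd k (x + 1ℚ) * ((x + 1ℚ) * (x + 1ℚ) - ι (suc k) * ι (suc k))    ≡⟨ cong₂ (λ u v → u * ((x + 1ℚ) * (x + 1ℚ) - v * v)) (proj₂ (sqProd-φ k x)) (ι-suc k) ⟩
    (x + 1ℚ + K) * (s * (P * Q)) * ((x + 1ℚ) * (x + 1ℚ) - (K + 1ℚ) * (K + 1ℚ))
      ≡⟨ solve 5 (λ x K s P Q → (x :+ con 1ℚ :+ K) :* (s :* (P :* Q)) :* ((x :+ con 1ℚ) :* (x :+ con 1ℚ) :- (K :+ con 1ℚ) :* (K :+ con 1ℚ))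
                  := (x :+ con 1ℚ :+ (K :+ con 1ℚ)) :* ((con (- 1ℚ) :* s) :* ((P :* (:- x :+ K)) :* (Q :* (x :+ con 0ℚ :+ con 0ℚ :+ con 1ℚ :+ K))))) refl x K s P Q ⟩
    (x + 1ℚ + (K + 1ℚ)) * (sgn (suc k) * φ (suc k) x)                               ≡⟨ cong (λ v → (x + 1ℚ + v) * (sgn (suc k) * φ (suc k) x)) (ι-suc k) ⟨
    (x + 1ℚ + ι (suc k)) * (sgn (suc k) * φ (suc k) x)                              ∎

Δ[x*sqProd] : ∀ k x → (x + 1ℚ) * sqProd k (x + 1ℚ) - x * sqProd k x ≡ oddℚ k * (sgn k * φ k x)
Δ[x*sqProd] k x = begin
  (x + 1ℚ) * sqProd k (x + 1ℚ) - x * sqProd k x                  ≡⟨ cong₂ _-_ (proj₂ (sqProd-φ k x)) (proj₁ (sqProd-φ k x)) ⟩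
  (x + 1ℚ + ι k) * (sgn k * φ k x) - (x - ι k) * (sgn k * φ k x) ≡⟨ solve 3 (λ x K A → (x :+ con 1ℚ :+ K) :* A :- (x :- K) :* A := (con (ι 2) :* K :+ con 1ℚ) :* A) refl x (ι k) (sgn k * φ k x) ⟩
  oddℚ k * (sgn k * φ k x)                                       ∎

sqProd-0 : ∀ k → sqProd k 0ℚ ≡ sgn k * (factℚ k * factℚ k)
sqProd-0 zero = refl
sqProd-0 (suc k) = begin
  sqProd k 0ℚ * (0ℚ * 0ℚ - ι (suc k) * ι (suc k))                    ≡⟨ cong (_* (0ℚ * 0ℚ - ι (suc k) * ι (suc k))) (sqProd-0 k) ⟩
  sgn k * (factℚ k * factℚ k) * (0ℚ * 0ℚ - ι (suc k) * ι (suc k))    ≡⟨ solve 3 (λ s f K → s :* (f :* f) :* (con 0ℚ :* con 0ℚ :- K :* K) := (con (- 1ℚ) :* s) :* ((K :* f) :* (K :* f))) refl (sgn k) (factℚ k) (ι (suc k)) ⟩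
  sgn (suc k) * (factℚ (suc k) * factℚ (suc k))                      ∎

sqProdP : ℕ → Poly
sqProdP zero = 1ℚ ∷ []
sqProdP (suc k) = mulP (sqProdP k) ((- (ι (suc k) * ι (suc k))) ∷ 0ℚ ∷ 1ℚ ∷ [])

evalP-sqProdP : ∀ k x → evalP (sqProdP k) x ≡ sqProd k x
evalP-sqProdP zero = solve 1 (λ x → con 1ℚ :+ x :* con 0ℚ := con 1ℚ) refl
evalP-sqProdP (suc k) x = trans (evalP-mulP (sqProdP k) _ x) (cong₂ _*_ (evalP-sqProdP k x)
  (solve 2 (λ x j → :- (j :* j) :+ x :* (con 0ℚ :+ x :* (con 1ℚ :+ x :* con 0ℚ)) := x :* x :- j :* j) refl x (ι (suc k))))

sumToP : ℕ → (ℕ → Poly) → Poly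
sumToP zero ps = ps 0
sumToP (suc n) ps = addP (sumToP n ps) (ps (suc n))

evalP-sumToP : ∀ n ps x → evalP (sumToP n ps) x ≡ sumTo n (λ k → evalP (ps k) x)
evalP-sumToP zero ps x = refl
evalP-sumToP (suc n) ps x = trans (evalP-addP (sumToP n ps) (ps (suc n)) x) (cong (_+ evalP (ps (suc n)) x) (evalP-sumToP n ps x))

antidiffWeight : ℕ → ℕ → ℚ
antidiffWeight n k = racahCoeff n k * (sgn k * inv (oddℚ k))

sqProdSum : ℕ → Poly
sqProdSum n = sumToP n (λ k → scaleP (antidiffWeight n k) (sqProdP k))

racahAntidiff : ℕ → Poly
racahAntidiff n = 0ℚ ∷ sqProdSum n

evalP-sqProdSum : ∀ n x → evalP (sqProdSum n) x ≡ sumTo n (λ k → antidiffWeight n k * sqProd k x)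
evalP-sqProdSum n x = trans (evalP-sumToP n _ x)
  (sumTo-cong n (λ k _ → trans (evalP-scaleP (antidiffWeight n k) (sqProdP k) x) (cong (antidiffWeight n k *_) (evalP-sqProdP k x))))

evalP-racahAntidiff : ∀ n x → evalP (racahAntidiff n) x ≡ sumTo n (λ k → antidiffWeight n k * (x * sqProd k x))
evalP-racahAntidiff n x = begin
  0ℚ + x * evalP (sqProdSum n) x                             ≡⟨ +-identityˡ _ ⟩
  x * evalP (sqProdSum n) x                                   ≡⟨ cong (x *_) (evalP-sqProdSum n x) ⟩
  x * sumTo n (λ k → antidiffWeight n k * sqProd k x)         ≡⟨ sumTo-* n x _ ⟨
  sumTo n (λ k → x * (antidiffWeight n k * sqProd k x))       ≡⟨ sumTo-cong n (λ k _ → solve 3 (λ x w h → x :* (w :* h) := w :* (x :* h)) refl x (antidiffWeight n k) (sqProd k x)) ⟩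
  sumTo n (λ k → antidiffWeight n k * (x * sqProd k x))       ∎

Δ-racahAntidiff : ∀ n x → evalP (racahAntidiff n) (x + 1ℚ) - evalP (racahAntidiff n) x ≡ racahRHS 0ℚ β₀ 0ℚ 0ℚ n x
Δ-racahAntidiff n x = begin
  evalP (racahAntidiff n) (x + 1ℚ) - evalP (racahAntidiff n) x    ≡⟨ cong₂ _-_ (evalP-racahAntidiff n (x + 1ℚ)) (evalP-racahAntidiff n x) ⟩
  sumTo n (λ k → w k * G k (x + 1ℚ)) - sumTo n (λ k → w k * G k x)  ≡⟨ sumTo-diff n _ _ ⟨
  sumTo n (λ k → w k * G k (x + 1ℚ) - w k * G k x)                  ≡⟨ sumTo-cong n (λ k _ → termwise k) ⟩
  sumTo n (λ k → racahCoeff n k * φ k x)                            ≡⟨ racahRHS≡Σφ n x ⟨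
  racahRHS 0ℚ β₀ 0ℚ 0ℚ n x                                          ∎
  where
  w = antidiffWeight n
  G = λ k y → y * sqProd k y
  termwise : ∀ k → w k * G k (x + 1ℚ) - w k * G k x ≡ racahCoeff n k * φ k x
  termwise k = begin
    w k * G k (x + 1ℚ) - w k * G k x                                              ≡⟨ solve 3 (λ a b c → a :* b :- a :* c := a :* (b :- c)) refl (w k) (G k (x + 1ℚ)) (G k x) ⟩
    w k * (G k (x + 1ℚ) - G k x)                                                  ≡⟨ cong (w k *_) (Δ[x*sqProd] k x) ⟩
    racahCoeff n k * (sgn k * inv (oddℚ k)) * (oddℚ k * (sgn k * φ k x))          ≡⟨ solve 5 (λ c s i o f → c :* (s :* i) :* (o :* (s :* f)) := c :* f :* (s :* s) :* (o :* i)) refl (racahCoeff n k) (sgn k) (inv (oddℚ k)) (oddℚ k) (φ k x) ⟩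
    racahCoeff n k * φ k x * (sgn k * sgn k) * (oddℚ k * inv (oddℚ k))             ≡⟨ cong₂ (λ u v → racahCoeff n k * φ k x * u * v) (sgn*sgn≡1 k) (inv-inverseʳ (oddℚ≢0 k)) ⟩
    racahCoeff n k * φ k x * 1ℚ * 1ℚ                                               ≡⟨ solve 1 (λ a → a :* con 1ℚ :* con 1ℚ := a) refl (racahCoeff n k * φ k x) ⟩
    racahCoeff n k * φ k x                                                         ∎

gosperTerm : ℕ → ℕ → ℚ
gosperTerm n k = negPoch n k * shiftPoch n k * inv (halfPoch k) * inv (factℚ k) * inv (oddℚ k)

linearCoeff-racahAntidiff : ∀ n → linearCoeff (racahAntidiff n) ≡ sumTo n (gosperTerm n)
linearCoeff-racahAntidiff n = trans (evalP-sqProdSum n 0ℚ) (sumTo-cong n (λ k _ → termwise k))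
  where
  f = factℚ
  termwise : ∀ k → antidiffWeight n k * sqProd k 0ℚ ≡ gosperTerm n k
  termwise k = begin
    (negPoch n k * shiftPoch n k) * inv (racahDen k) * (sgn k * inv (oddℚ k)) * sqProd k 0ℚ
      ≡⟨ cong₂ (λ u v → (negPoch n k * shiftPoch n k) * u * (sgn k * inv (oddℚ k)) * v) inv-racahDen (sqProd-0 k) ⟩
    (negPoch n k * shiftPoch n k) * (inv (f k) * inv (halfPoch k) * inv (f k) * inv (f k)) * (sgn k * inv (oddℚ k)) * (sgn k * (f k * f k))
      ≡⟨ solve 8 (λ a b F D s O f′ f → (a :* b) :* (F :* D :* F :* F) :* (s :* O) :* (s :* (f :* f)) := a :* b :* D :* F :* O :* (s :* s) :* (f :* F) :* (f :* F))
                 refl (negPoch n k) (shiftPoch n k) (inv (f k)) (inv (halfPoch k)) (sgn k) (inv (oddℚ k)) (f k) (f k) ⟩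
    gosperTerm n k * (sgn k * sgn k) * (f k * inv (f k)) * (f k * inv (f k))
      ≡⟨ cong₂ (λ u v → gosperTerm n k * u * v * v) (sgn*sgn≡1 k) (inv-inverseʳ (factℚ≢0 k)) ⟩
    gosperTerm n k * 1ℚ * 1ℚ * 1ℚ
      ≡⟨ solve 1 (λ t → t :* con 1ℚ :* con 1ℚ :* con 1ℚ := t) refl (gosperTerm n k) ⟩
    gosperTerm n k ∎
    where
    inv-racahDen : inv (racahDen k) ≡ inv (f k) * inv (halfPoch k) * inv (f k) * inv (f k)
    inv-racahDen = begin
      inv (poch (0ℚ + 1ℚ) k * halfPoch k * poch (0ℚ + 1ℚ) k * f k)   ≡⟨ cong (λ p → inv (p * halfPoch k * p * f k)) (poch-1 k) ⟩
      inv (f k * halfPoch k * f k * f k)                             ≡⟨ inv-* (*-≢0 (*-≢0 (factℚ≢0 k) (halfPoch≢0 k)) (factℚ≢0 k)) (factℚ≢0 k) ⟩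
      inv (f k * halfPoch k * f k) * inv (f k)                       ≡⟨ cong (_* inv (f k)) (inv-* (*-≢0 (factℚ≢0 k) (halfPoch≢0 k)) (factℚ≢0 k)) ⟩
      inv (f k * halfPoch k) * inv (f k) * inv (f k)                 ≡⟨ cong (λ z → z * inv (f k) * inv (f k)) (inv-* (factℚ≢0 k) (halfPoch≢0 k)) ⟩
      inv (f k) * inv (halfPoch k) * inv (f k) * inv (f k)           ∎

-- Gosper's certificate: the partial sums of gosperTerm n are a hypergeometric term.
gosper-partialSum : ∀ n K → ι n * oddℚ n * sumTo K (gosperTerm n)
                            + negPoch n (suc K) * shiftPoch n (suc K) * inv (factℚ K) * inv (halfPoch (suc K)) ≡ 0ℚ
gosper-partialSum n zero = solve 1 (λ N → N :* (con (ι 2) :* N :+ con 1ℚ) :* (con 1ℚ :* con 1ℚ :* con (inv 1ℚ) :* con (inv 1ℚ) :* con (inv (ι 2 * ι 0 + 1ℚ)))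
    :+ (con 1ℚ :* (:- N :+ con (ι 0))) :* (con 1ℚ :* (N :+ con 0ℚ :+ con β₀ :+ con 1ℚ :+ con (ι 0))) :* con (inv 1ℚ) :* con (inv (1ℚ * (β₀ + 0ℚ + 1ℚ + ι 0))) := con 0ℚ) refl (ι n)
gosper-partialSum n (suc K) = begin
  ι n * oddℚ n * (S + A * B * D * inv (factℚ (suc K)) * v) + A * (- N + K+1) * (B * (N + 0ℚ + β₀ + 1ℚ + K+1)) * inv (factℚ (suc K)) * inv (halfPoch (suc K) * e)
    ≡⟨ cong₂ (λ p q → ι n * oddℚ n * (S + A * B * D * p * v) + A * (- N + K+1) * (B * (N + 0ℚ + β₀ + 1ℚ + K+1)) * p * q) inv-factℚ inv-halfPoch ⟩
  ι n * oddℚ n * (S + A * B * D * (u * F) * v) + A * (- N + K+1) * (B * (N + 0ℚ + β₀ + 1ℚ + K+1)) * (u * F) * (D * (ι 2 * v))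
    ≡⟨ solve 9 (λ N K+1 A B F D u v S →
         N :* (con (ι 2) :* N :+ con 1ℚ) :* (S :+ A :* B :* D :* (u :* F) :* v) :+ A :* (:- N :+ K+1) :* (B :* (N :+ con 0ℚ :+ con β₀ :+ con 1ℚ :+ K+1)) :* (u :* F) :* (D :* (con (ι 2) :* v))
         := (N :* (con (ι 2) :* N :+ con 1ℚ) :* S :+ A :* B :* F :* D) :+ A :* B :* F :* D :* (con (- 1ℚ) :+ (K+1 :* u) :* ((con (ι 2) :* K+1 :+ con 1ℚ) :* v)))
         refl N K+1 A B F D u v S ⟩
  (ι n * oddℚ n * S + A * B * F * D) + A * B * F * D * (- 1ℚ + (K+1 * u) * (oddℚ (suc K) * v))
    ≡⟨ cong₂ (λ a b → a + A * B * F * D * (- 1ℚ + b)) (gosper-partialSum n K) (cong₂ _*_ (inv-inverseʳ (ι-suc≢0 K)) (inv-inverseʳ (oddℚ≢0 (suc K)))) ⟩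
  0ℚ + A * B * F * D * (- 1ℚ + 1ℚ * 1ℚ)
    ≡⟨ solve 1 (λ z → con 0ℚ :+ z :* (con (- 1ℚ) :+ con 1ℚ :* con 1ℚ) := con 0ℚ) refl (A * B * F * D) ⟩
  0ℚ ∎
  where
  N = ι n
  K+1 = ι (suc K)
  A = negPoch n (suc K)
  B = shiftPoch n (suc K)
  F = inv (factℚ K)
  D = inv (halfPoch (suc K))
  S = sumTo K (gosperTerm n)
  u = inv K+1
  v = inv (oddℚ (suc K))
  e = β₀ + 0ℚ + 1ℚ + K+1
  inv-factℚ : inv (factℚ (suc K)) ≡ u * F
  inv-factℚ = inv-* (ι-suc≢0 K) (factℚ≢0 K)
  inv-halfPoch : inv (halfPoch (suc K) * e) ≡ D * (ι 2 * v)
  inv-halfPoch = trans (inv-* (halfPoch≢0 (suc K)) (halfPoch-factor≢0 (suc K))) (cong (D *_) (inv-halfPoch-factor (suc K)))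

gosper-sum : ∀ n → sumTo (suc n) (gosperTerm (suc n)) ≡ 0ℚ
gosper-sum n = p*q≡0⇒q≡0 (*-≢0 (ι-suc≢0 n) (oddℚ≢0 (suc n))) (begin
  c * S                                ≡⟨ +-identityʳ (c * S) ⟨
  c * S + 0ℚ                           ≡⟨ cong (λ z → c * S + z) (*-zeroˡ (B * F * D)) ⟨
  c * S + 0ℚ * (B * F * D)             ≡⟨ cong (λ a → c * S + a * (B * F * D)) top-negPoch≡0 ⟨
  c * S + A * (B * F * D)              ≡⟨ solve 5 (λ p a b f d → p :+ a :* (b :* f :* d) := p :+ a :* b :* f :* d) refl (c * S) A B F D ⟩
  c * S + A * B * F * D                ≡⟨ gosper-partialSum m m ⟩
  0ℚ                                   ∎)
  where
  m = suc n
  c = ι m * oddℚ m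
  S = sumTo m (gosperTerm m)
  A = negPoch m (suc m)
  B = shiftPoch m (suc m)
  F = inv (factℚ m)
  D = inv (halfPoch (suc m))
  top-negPoch≡0 : A ≡ 0ℚ
  top-negPoch≡0 = trans (cong (negPoch m m *_) (+-inverseˡ (ι m))) (*-zeroʳ (negPoch m m))

evalP-X²+X : ∀ x → evalP X²+X x ≡ λ₀ x
evalP-X²+X = solve 1 (λ x → con 0ℚ :+ x :* (con 1ℚ :+ x :* (con 1ℚ :+ x :* con 0ℚ)) := x :* (x :+ con 0ℚ :+ con 0ℚ :+ con 1ℚ)) refl

bernoulli-B₀ : ∀ {B} → IsBernoulli B → B 0 ≡ 1ℚ
bernoulli-B₀ {B} isBernoulli =
  trans (solve 2 (λ b c → b := b :* con (inv 1ℚ) :* con (inv (factℚ 1)) :+ c :* con 0ℚ) refl (B 0) (B 1 ÷' factℚ 1)) (isBernoulli 1)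

-- The moments of the form p ↦ Ψ (p ∘ q).
composedMoments : (ℕ → ℚ) → Poly → ℕ → ℚ
composedMoments Ψ q i = applyForm Ψ (powP q i)

bernoulli-racah-orthogonal : ∀ {B} → IsBernoulli B → ∀ {R} → IsRacahFamily 0ℚ β₀ 0ℚ 0ℚ R →
                             ∀ n → applyForm (composedMoments B X²+X) (R (suc n)) ≡ 0ℚ
bernoulli-racah-orthogonal {B} isBernoulli {R} isRacah n = begin
  applyForm (composedMoments B X²+X) (R (suc n))   ≡⟨ applyForm-combine B (R (suc n)) (powP X²+X) ⟨
  applyForm B (combine (R (suc n)) (powP X²+X))     ≡⟨ applyForm-Δ {B} isBernoulli (racahAntidiff (suc n)) (combine (R (suc n)) (powP X²+X)) R∘λ₀≡Δ ⟩
  linearCoeff (racahAntidiff (suc n))               ≡⟨ linearCoeff-racahAntidiff (suc n) ⟩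
  sumTo (suc n) (gosperTerm (suc n))                ≡⟨ gosper-sum n ⟩
  0ℚ                                                ∎
  where
  R∘λ₀≡Δ : ∀ x → evalP (combine (R (suc n)) (powP X²+X)) x
               ≡ evalP (racahAntidiff (suc n)) (x + 1ℚ) - evalP (racahAntidiff (suc n)) x
  R∘λ₀≡Δ x = begin
    evalP (combine (R (suc n)) (powP X²+X)) x      ≡⟨ evalP-compose (R (suc n)) X²+X x ⟩
    evalP (R (suc n)) (evalP X²+X x)              ≡⟨ cong (evalP (R (suc n))) (evalP-X²+X x) ⟩
    evalP (R (suc n)) (λ₀ x)                      ≡⟨ isRacah (suc n) x ⟩
    racahRHS 0ℚ β₀ 0ℚ 0ℚ (suc n) x                ≡⟨ Δ-racahAntidiff (suc n) x ⟨
    evalP (racahAntidiff (suc n)) (x + 1ℚ) - evalP (racahAntidiff (suc n)) x ∎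

-- Uniqueness of the moment functional

k*[1+k]-injective : Injective _≡_ _≡_ (λ k → k ℕ.* suc k)
k*[1+k]-injective {j} {k} e with ℕP.<-cmp j k
... | tri< j<k _ _ = contradiction e (ℕP.<⇒≢ (ℕP.*-mono-< j<k (ℕ.s≤s j<k)))
... | tri≈ _ j≡k _ = j≡k
... | tri> _ _ k<j = contradiction (sym e) (ℕP.<⇒≢ (ℕP.*-mono-< k<j (ℕ.s≤s k<j)))

λ₀∘ι-injective : Injective _≡_ _≡_ (λ k → λ₀ (ι k))
λ₀∘ι-injective {j} {k} e = k*[1+k]-injective (ι-injective (trans (sym (λ₀-ι j)) (trans e (λ₀-ι k))))
  where
  λ₀-ι : ∀ k → λ₀ (ι k) ≡ ι (k ℕ.* suc k)
  λ₀-ι k = begin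
    ι k * (ι k + 0ℚ + 0ℚ + 1ℚ)   ≡⟨ cong (ι k *_) (solve 1 (λ a → a :+ con 0ℚ :+ con 0ℚ :+ con 1ℚ := a :+ con 1ℚ) refl (ι k)) ⟩
    ι k * (ι k + 1ℚ)             ≡⟨ cong (ι k *_) (ι-suc k) ⟨
    ι k * ι (suc k)              ≡⟨ ι-* k (suc k) ⟨
    ι (k ℕ.* suc k)              ∎

module RacahUniqueness {R : ℕ → Poly} (isRacah : IsRacahFamily 0ℚ β₀ 0ℚ 0ℚ R)
                       (d : ℕ → ℚ) (d[1]≡0 : applyForm d (1ℚ ∷ []) ≡ 0ℚ)
                       (d[R]≡0 : ∀ n → applyForm d (R (suc n)) ≡ 0ℚ) where

  Annihilated : (ℚ → ℚ) → Set
  Annihilated f = Σ Poly λ P → (∀ x → evalP P (λ₀ x) ≡ f x) × applyForm d P ≡ 0ℚ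

  annihilated-cong : ∀ {f g} → (∀ x → f x ≡ g x) → Annihilated f → Annihilated g
  annihilated-cong f≗g (P , P∘λ₀≡f , dP≡0) = P , (λ x → trans (P∘λ₀≡f x) (f≗g x)) , dP≡0

  annihilated-+ : ∀ {f g} → Annihilated f → Annihilated g → Annihilated (λ x → f x + g x)
  annihilated-+ (P , P∘λ₀≡f , dP≡0) (Q , Q∘λ₀≡g , dQ≡0) =
    addP P Q , (λ x → trans (evalP-addP P Q (λ₀ x)) (cong₂ _+_ (P∘λ₀≡f x) (Q∘λ₀≡g x))) ,
    trans (applyForm-addP d P Q) (cong₂ _+_ dP≡0 dQ≡0)

  annihilated-* : ∀ c {f} → Annihilated f → Annihilated (λ x → c * f x)
  annihilated-* c (P , P∘λ₀≡f , dP≡0) =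
    scaleP c P , (λ x → trans (evalP-scaleP c P (λ₀ x)) (cong (c *_) (P∘λ₀≡f x))) ,
    trans (applyForm-scaleP d c P) (trans (cong (c *_) dP≡0) (*-zeroʳ c))

  annihilated-diff : ∀ {f g} → Annihilated f → Annihilated g → Annihilated (λ x → f x - g x)
  annihilated-diff {f} {g} af ag = annihilated-cong
    (λ x → solve 2 (λ a b → a :+ con (- 1ℚ) :* b := a :- b) refl (f x) (g x))
    (annihilated-+ af (annihilated-* (- 1ℚ) ag))

  annihilated-sumTo : ∀ N (F : ℕ → ℚ → ℚ) → (∀ k → k ℕ.≤ N → Annihilated (F k)) → Annihilated (λ x → sumTo N (λ k → F k x))
  annihilated-sumTo zero F aF = aF 0 ℕ.z≤n
  annihilated-sumTo (suc N) F aF =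
    annihilated-+ (annihilated-sumTo N F (λ k k≤N → aF k (ℕP.m≤n⇒m≤1+n k≤N))) (aF (suc N) ℕP.≤-refl)

  annihilated-φ₀ : Annihilated (φ 0)
  annihilated-φ₀ = (1ℚ ∷ []) , (λ x → solve 1 (λ y → con 1ℚ :+ y :* con 0ℚ := con 1ℚ) refl (λ₀ x)) , d[1]≡0

  -- R n ∘ λ₀ = Σ_{k ≤ n} c n k · φ k is triangular with nonzero diagonal, so it can be solved for φ n.
  φ-top : ∀ n x → φ (suc n) x ≡ inv (racahCoeff (suc n) (suc n)) * (racahRHS 0ℚ β₀ 0ℚ 0ℚ (suc n) x - sumTo n (λ k → racahCoeff (suc n) k * φ k x))
  φ-top n x = begin
    φ (suc n) x                               ≡⟨ *-identityˡ (φ (suc n) x) ⟨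
    1ℚ * φ (suc n) x                          ≡⟨ cong (_* φ (suc n) x) (inv-inverseʳ (racahCoeff≢0 (suc n))) ⟨
    c * inv c * φ (suc n) x                   ≡⟨ solve 4 (λ f i c S → c :* i :* f := i :* ((S :+ c :* f) :- S)) refl (φ (suc n) x) (inv c) c S ⟩
    inv c * ((S + c * φ (suc n) x) - S)       ≡⟨ cong (λ z → inv c * (z - S)) (racahRHS≡Σφ (suc n) x) ⟨
    inv c * (racahRHS 0ℚ β₀ 0ℚ 0ℚ (suc n) x - S) ∎
    where c = racahCoeff (suc n) (suc n)
          S = sumTo n (λ k → racahCoeff (suc n) k * φ k x)

  annihilated-φ-≤ : ∀ n k → k ℕ.≤ n → Annihilated (φ k)
  annihilated-φ-≤ zero zero _ = annihilated-φ₀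
  annihilated-φ-≤ (suc n) k k≤1+n with ℕP.m≤n⇒m<n∨m≡n k≤1+n
  ... | inj₁ (ℕ.s≤s k≤n) = annihilated-φ-≤ n k k≤n
  ... | inj₂ refl = annihilated-cong (λ x → sym (φ-top n x))
        (annihilated-* (inv (racahCoeff (suc n) (suc n))) (annihilated-diff (R (suc n) , isRacah (suc n) , d[R]≡0 n)
          (annihilated-sumTo n (λ k x → racahCoeff (suc n) k * φ k x)
            (λ k k≤n → annihilated-* (racahCoeff (suc n) k) (annihilated-φ-≤ n k k≤n)))))

  annihilated-λ₀^*φ : ∀ j k → Annihilated (λ x → λ₀ x ^ℚ j * φ k x)
  annihilated-λ₀^*φ zero k = annihilated-cong (λ x → sym (*-identityˡ (φ k x))) (annihilated-φ-≤ k k ℕP.≤-refl)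
  annihilated-λ₀^*φ (suc j) k = annihilated-cong λ₀^[1+j]*φ
    (annihilated-diff (annihilated-* (ι k * (ι k + 1ℚ)) (annihilated-λ₀^*φ j k)) (annihilated-λ₀^*φ j (suc k)))
    where
    λ₀^[1+j]*φ : ∀ x → ι k * (ι k + 1ℚ) * (λ₀ x ^ℚ j * φ k x) - λ₀ x ^ℚ j * φ (suc k) x ≡ λ₀ x * λ₀ x ^ℚ j * φ k x
    λ₀^[1+j]*φ x = begin
      ι k * (ι k + 1ℚ) * (L * φ k x) - L * φ (suc k) x    ≡⟨ solve 4 (λ c L p q → c :* (L :* p) :- L :* q := L :* (c :* p :- q)) refl (ι k * (ι k + 1ℚ)) L (φ k x) (φ (suc k) x) ⟩
      L * (ι k * (ι k + 1ℚ) * φ k x - φ (suc k) x)         ≡⟨ cong (L *_) (λ₀*φ k x) ⟨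
      L * (λ₀ x * φ k x)                                   ≡⟨ solve 3 (λ L l p → L :* (l :* p) := l :* L :* p) refl L (λ₀ x) (φ k x) ⟩
      λ₀ x * L * φ k x                                     ∎
      where L = λ₀ x ^ℚ j

  moments≡0 : ∀ n → d n ≡ 0ℚ
  moments≡0 n = begin
    d n                        ≡⟨ applyForm-X^ d n ⟨
    applyForm d (powP X n)     ≡⟨ applyForm-cong-on λ₀∘ι-injective d (powP X n) P X^n≡P ⟩
    applyForm d P              ≡⟨ dP≡0 ⟩
    0ℚ                         ∎
    where
    P = proj₁ (annihilated-λ₀^*φ n 0)
    P∘λ₀≡λ₀^n = proj₁ (proj₂ (annihilated-λ₀^*φ n 0))
    dP≡0 = proj₂ (proj₂ (annihilated-λ₀^*φ n 0))
    X^n≡P : ∀ k → evalP (powP X n) (λ₀ (ι k)) ≡ evalP P (λ₀ (ι k))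
    X^n≡P k = begin
      evalP (powP X n) y       ≡⟨ evalP-powP X n y ⟩
      evalP X y ^ℚ n           ≡⟨ cong (_^ℚ n) (evalP-X y) ⟩
      y ^ℚ n                   ≡⟨ *-identityʳ (y ^ℚ n) ⟨
      y ^ℚ n * φ 0 (ι k)       ≡⟨ P∘λ₀≡λ₀^n (ι k) ⟨
      evalP P y                ∎
      where y = λ₀ (ι k)

racah-form-unique : ∀ {R} → IsRacahFamily 0ℚ β₀ 0ℚ 0ℚ R → ∀ {m m′} →
                    applyForm m (1ℚ ∷ []) ≡ applyForm m′ (1ℚ ∷ []) →
                    (∀ n → applyForm m (R (suc n)) ≡ 0ℚ) → (∀ n → applyForm m′ (R (suc n)) ≡ 0ℚ) →
                    ∀ n → m n ≡ m′ n
racah-form-unique {R} isRacah {m} {m′} m[1]≡m′[1] m[R]≡0 m′[R]≡0 n =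
  x∙y⁻¹≈ε⇒x≈y (m n) (m′ n) (RacahUniqueness.moments≡0 {R} isRacah d d[1]≡0 d[R]≡0 n)
  where
  d : ℕ → ℚ
  d i = m i - m′ i
  d[1]≡0 : applyForm d (1ℚ ∷ []) ≡ 0ℚ
  d[1]≡0 = trans (applyForm-diff m m′ (1ℚ ∷ [])) (trans (cong (_- applyForm m′ (1ℚ ∷ [])) m[1]≡m′[1]) (+-inverseʳ (applyForm m′ (1ℚ ∷ []))))
  d[R]≡0 : ∀ n → applyForm d (R (suc n)) ≡ 0ℚ
  d[R]≡0 n = trans (applyForm-diff m m′ (R (suc n))) (cong₂ _-_ (m[R]≡0 n) (m′[R]≡0 n))

theorem2p1 : (B : ℕ → ℚ) → IsBernoulli B →
             (R : ℕ → Poly) → IsRacahFamily 0ℚ (- (1ℚ ÷' ι 2)) 0ℚ 0ℚ R →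
             (m : ℕ → ℚ) → applyForm m (1ℚ ∷ []) ≡ 1ℚ →
             (∀ n → applyForm m (R (suc n)) ≡ 0ℚ) →
             ∀ n → applyForm m (powP (0ℚ ∷ 1ℚ ∷ []) n) ≡ (ι 2 ^ℚ n) * Rminus B n
theorem2p1 B isBernoulli R isRacah m m[1]≡1 m[R]≡0 n = begin
  applyForm m (powP X n)                                 ≡⟨ applyForm-X^ m n ⟩
  m n                                                    ≡⟨ racah-form-unique {R} isRacah {m} {composedMoments B X²+X} (trans m[1]≡1 (sym Λ[1]≡1)) m[R]≡0 (bernoulli-racah-orthogonal {B} isBernoulli {R} isRacah) n ⟩
  applyForm B (powP X²+X n)                              ≡⟨ applyForm-cong-on ι-injective B (powP X²+X n) (scaleP (ι 2 ^ℚ n) (powP binomX1-2 n)) (λ k → X²+X^n≡2^n*binom^n (ι k)) ⟩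
  applyForm B (scaleP (ι 2 ^ℚ n) (powP binomX1-2 n))     ≡⟨ applyForm-scaleP B (ι 2 ^ℚ n) (powP binomX1-2 n) ⟩
  ι 2 ^ℚ n * Rminus B n                                  ∎
  where
  Λ[1]≡1 : applyForm (composedMoments B X²+X) (1ℚ ∷ []) ≡ 1ℚ
  Λ[1]≡1 = trans (solve 1 (λ b → con 1ℚ :* (con 1ℚ :* b :+ con 0ℚ) :+ con 0ℚ := b) refl (B 0)) (bernoulli-B₀ {B} isBernoulli)
  X²+X^n≡2^n*binom^n : ∀ x → evalP (powP X²+X n) x ≡ evalP (scaleP (ι 2 ^ℚ n) (powP binomX1-2 n)) x
  X²+X^n≡2^n*binom^n x = begin
    evalP (powP X²+X n) x                                ≡⟨ evalP-powP X²+X n x ⟩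
    evalP X²+X x ^ℚ n                                    ≡⟨ cong (_^ℚ n) (solve 1 (λ x → con 0ℚ :+ x :* (con 1ℚ :+ x :* (con 1ℚ :+ x :* con 0ℚ)) := con (ι 2) :* (con 0ℚ :+ x :* (con (1ℚ ÷' ι 2) :+ x :* (con (1ℚ ÷' ι 2) :+ x :* con 0ℚ)))) refl x) ⟩
    (ι 2 * evalP binomX1-2 x) ^ℚ n                       ≡⟨ ^ℚ-distribʳ-* (ι 2) (evalP binomX1-2 x) n ⟩
    ι 2 ^ℚ n * evalP binomX1-2 x ^ℚ n                    ≡⟨ cong (ι 2 ^ℚ n *_) (evalP-powP binomX1-2 n x) ⟨
    ι 2 ^ℚ n * evalP (powP binomX1-2 n) x                ≡⟨ evalP-scaleP (ι 2 ^ℚ n) (powP binomX1-2 n) x ⟨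
    evalP (scaleP (ι 2 ^ℚ n) (powP binomX1-2 n)) x       ∎
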